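{- Let $P:\mathbb{N}_0\to\mathbb{N}_0$ be any map for which $\lim_{n\to\infty}P_n$ exists (possibly infinite). Then $$\lim_{n\to\infty}P(n;(1,P_n))=\begin{cases}0 & \text{if } \lim_{n\to\infty}P_n>1,\\ 1 & \text{if } \lim_{n\to\infty}P_n=1.\end{cases}$$
   Context: For positive integers $K\le P$ and $n\ge 2$, write $\theta=(K,P)$. The random key graph $\mathbb{K}(n;\theta)$ on vertex set $\{1,\dots,n\}$ is constructed as follows. Let $K_1(\theta),\dots,K_n(\theta)$ be i.i.d. random sets, each uniformly distributed over the collection of all $K$-element subsets of $\{1,\dots,P\}$. Distinct nodes $i,j$ are adjacent if and only if $K_i(\theta)\cap K_j(\theta)\neq\emptyset$. Write $P(n;\theta)$ for the probability that $\mathbb{K}(n;\theta)$ is connected. -}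

module Defs where

open import Data.Nat using (ℕ; zero; suc; _≤_; _≥_; _^_)
open import Data.Nat as ℕ using ()
open import Data.Bool using (Bool; true; false)
open import Data.Fin using (Fin)
open import Data.Fin.Subset using (Subset; _∩_; Nonempty) renaming (∣_∣ to ∣_∣ₛ)
open import Data.Vec using (Vec; []; _∷_; lookup)
open import Data.List using (List; []; _∷_; map; concatMap; filter; length; _++_)
open import Data.Product using (Σ; _×_; ∃; ∃-syntax)
open import Data.Integer using (+_)
open import Data.Rational using (ℚ; _/_; 0ℚ; 1ℚ; _-_; ∣_∣; _<_)
open import Relation.Nullary using (¬_; Dec; does)
open import Relation.Binary.PropositionalEquality using (_≡_)

allSubsets : (P : ℕ) → List (Subset P)
allSubsets zero = [] ∷ []
allSubsets (suc P) = concatMap (λ s → (true ∷ s) ∷ (false ∷ s) ∷ []) (allSubsets P)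

-- All K-element subsets of {1..P}: the sample space of a single key ring K_i(θ).
kSubsets : (K P : ℕ) → List (Subset P)
kSubsets K P = filter (λ s → ∣ s ∣ₛ ℕ.≟ K) (allSubsets P)

tuples : {A : Set} → List A → (n : ℕ) → List (Vec A n)
tuples xs zero = [] ∷ []
tuples xs (suc n) = concatMap (λ x → map (x ∷_) (tuples xs n)) xs

Adj : {n P : ℕ} → Vec (Subset P) n → Fin n → Fin n → Set
Adj keys i j = ¬ (i ≡ j) × Nonempty (lookup keys i ∩ lookup keys j)

data Reach {n P : ℕ} (keys : Vec (Subset P) n) : Fin n → Fin n → Set where
  here : ∀ {i} → Reach keys i i
  step : ∀ {i j k} → Adj keys i j → Reach keys j k → Reach keys i k

Connected : {n P : ℕ} → Vec (Subset P) n → Set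
Connected {n} keys = ∀ (i j : Fin n) → Reach keys i j

-- Any decision procedure for connectivity (all such procedures give the same counts).
ConnDecider : Set
ConnDecider = ∀ {n P : ℕ} (keys : Vec (Subset P) n) → Dec (Connected keys)

-- a / d as a rational, with a harmless convention for d = 0.
ratio : ℕ → ℕ → ℚ
ratio a zero = 0ℚ
ratio a (suc d) = (+ a) / suc d

-- P(n;θ) for θ = (K,P): number of connected realisations over the number of
-- realisations (the K_i are i.i.d. uniform over K-subsets).
connProb : ConnDecider → (n K P : ℕ) → ℚ
connProb dec n K P =
  ratio (length (filter dec (tuples (kSubsets K P) n)))
        (length (kSubsets K P) ^ n)

-- Limits of ℕ-valued sequences (discrete topology on ℕ, plus +∞).
ConvergesToℕ : (ℕ → ℕ) → ℕ → Set
ConvergesToℕ f L = ∃[ N ] (∀ n → n ≥ N → f n ≡ L)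

DivergesToInfinity : (ℕ → ℕ) → Set
DivergesToInfinity f = ∀ M → ∃[ N ] (∀ n → n ≥ N → f n ≥ M)

Tendsto : (ℕ → ℚ) → ℚ → Set
Tendsto q l = ∀ (ε : ℚ) → 0ℚ < ε → ∃[ N ] (∀ n → n ≥ N → ∣ q n - l ∣ < ε)

module Submission where

-- When every node draws a single key out of P, two nodes are adjacent iff
-- they drew the same key, so the graph is a disjoint union of cliques and
-- it is connected iff all nodes drew the same key.  Hence among the P^n
-- equally likely realisations at most P are connected (exactly one for each
-- key), giving P(n;(1,P)) ≤ P / P^n, which tends to 0 as soon as P ≥ 2;
-- for P = 1 the graph is complete and P(n;(1,1)) = 1.

open import Defs
open import Function using (_∘_)
open import Data.Nat using (ℕ; zero; suc; _+_; _*_; _^_; _≤_; _<_; _≥_; _>_; _⊔_; z≤n; s≤s; >-nonZero)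
open import Data.Nat as ℕ using ()
open import Data.Nat.Properties
  using (≤-trans; <-≤-trans; ≤-<-trans; ≤-pred; +-suc; +-identityʳ; +-mono-≤; +-monoˡ-≤;
         *-monoˡ-≤; *-monoʳ-<; *-zeroʳ; m≤n*m; m^n>0; ^-monoˡ-≤; ^-zeroˡ; m≤m⊔n; m≤n⊔m;
         m≤n⇒m≤1+n; ≤-antisym; n≮0; suc-injective; module ≤-Reasoning)
open import Data.Nat.Combinatorics using (_C_; nC1≡n; nCk+nC[k+1]≡[n+1]C[k+1])
open import Data.Nat.Coprimality using (Coprime)
open import Data.Bool using () renaming (_≟_ to _≟ᵇ_)
open import Data.Fin using (Fin; zero; suc) renaming (_≟_ to _≟ᶠ_)
open import Data.Fin.Subset using (Subset; ⊥; ⁅_⁆; _∈_; _∩_; Nonempty; inside; outside) renaming (∣_∣ to ∣_∣ₛ)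
open import Data.Fin.Subset.Properties using (x∈p∩q⁺; x∈p∩q⁻; ∉⊥)
open import Data.Vec using (Vec; []; _∷_; lookup; replicate; here; there)
open import Data.Vec.Properties using (≡-dec; ∷-injectiveˡ; ∷-injectiveʳ; lookup-replicate)
open import Data.List using (List; []; _∷_; map; concatMap; filter; length; _++_)
open import Data.List.Properties using (filter-++; length-++; ++-identityʳ)
open import Data.List.Relation.Unary.Any as Any using ()
open import Data.List.Membership.Propositional using (find) renaming (_∈_ to _∈ₗ_)
open import Data.List.Membership.Propositional.Properties using (∈-concatMap⁻; ∈-map⁻; ∈-filter⁻)
open import Data.Product using (_×_; _,_; proj₂; ∃-syntax)
open import Data.Empty using (⊥-elim)
open import Data.Integer as ℤ using (+_; +[1+_]; -[1+_])
open import Data.Integer.Properties using (pos-*)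
open import Data.Rational using (ℚ; mkℚ; 0ℚ; 1ℚ; _-_; ∣_∣; *<*) renaming (_<_ to _<ℚ_)
open import Data.Rational.Properties
  using (+-inverseʳ; 0≤p⇒∣p∣≡p; nonNegative⁻¹; normalize-nonNeg; toℚᵘ-cancel-<; toℚᵘ-fromℚᵘ)
  renaming (+-identityʳ to +-identityʳℚ)
open import Data.Rational.Unnormalised as ℚᵘ using (mkℚᵘ)
open import Data.Rational.Unnormalised.Properties as ℚᵘ using ()
open import Relation.Nullary using (¬_; yes; no)
open import Relation.Unary using (Decidable)
open import Relation.Binary.Definitions using (DecidableEquality)
open import Relation.Binary.PropositionalEquality using (_≡_; refl; sym; trans; cong; cong₂; subst; subst₂; module ≡-Reasoning)

count : {A : Set} {P : A → Set} → Decidable P → List A → ℕ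
count P? xs = length (filter P? xs)

count-mono : {A : Set} {P Q : A → Set} (P? : Decidable P) (Q? : Decidable Q) (xs : List A) →
  (∀ {x} → x ∈ₗ xs → P x → Q x) → count P? xs ≤ count Q? xs
count-mono P? Q? [] P⇒Q = z≤n
count-mono P? Q? (x ∷ xs) P⇒Q with P? x | Q? x
... | yes _  | yes _  = s≤s (count-mono P? Q? xs (P⇒Q ∘ Any.there))
... | yes px | no ¬qx = ⊥-elim (¬qx (P⇒Q (Any.here refl) px))
... | no _   | yes _  = m≤n⇒m≤1+n (count-mono P? Q? xs (P⇒Q ∘ Any.there))
... | no _   | no _   = count-mono P? Q? xs (P⇒Q ∘ Any.there)

count-cong : {A : Set} {P Q : A → Set} (P? : Decidable P) (Q? : Decidable Q) (xs : List A) →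
  (∀ {x} → P x → Q x) → (∀ {x} → Q x → P x) → count P? xs ≡ count Q? xs
count-cong P? Q? xs P⇒Q Q⇒P =
  ≤-antisym (count-mono P? Q? xs (λ _ → P⇒Q)) (count-mono Q? P? xs (λ _ → Q⇒P))

count-none : {A : Set} {P : A → Set} (P? : Decidable P) (xs : List A) →
  (∀ {x} → ¬ P x) → count P? xs ≡ 0
count-none P? [] ¬P = refl
count-none P? (x ∷ xs) ¬P with P? x
... | yes px = ⊥-elim (¬P px)
... | no _   = count-none P? xs ¬P

count-single : {A : Set} {P : A → Set} (P? : Decidable P) {x : A} → P x → count P? (x ∷ []) ≡ 1
count-single P? {x} px with P? x
... | yes _  = refl
... | no ¬px = ⊥-elim (¬px px)

count-++ : {A : Set} {P : A → Set} (P? : Decidable P) (xs ys : List A) →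
  count P? (xs ++ ys) ≡ count P? xs + count P? ys
count-++ P? xs ys = trans (cong length (filter-++ P? xs ys)) (length-++ (filter P? xs))

count-map : {A B : Set} {P : B → Set} (P? : Decidable P) (f : A → B) (xs : List A) →
  count P? (map f xs) ≡ count (P? ∘ f) xs
count-map P? f [] = refl
count-map P? f (x ∷ xs) with P? (f x)
... | yes _ = cong suc (count-map P? f xs)
... | no _  = count-map P? f xs

count-filter : {A : Set} {P Q : A → Set} (P? : Decidable P) (Q? : Decidable Q) (xs : List A) →
  count P? (filter Q? xs) ≤ count P? xs
count-filter P? Q? [] = z≤n
count-filter P? Q? (x ∷ xs) with Q? x
... | yes _ with P? x
...   | yes _ = s≤s (count-filter P? Q? xs)
...   | no _  = count-filter P? Q? xs
count-filter P? Q? (x ∷ xs) | no _ with P? x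
...   | yes _ = m≤n⇒m≤1+n (count-filter P? Q? xs)
...   | no _  = count-filter P? Q? xs

count-interleave : {A B : Set} {P : B → Set} (P? : Decidable P) (f g : A → B) (xs : List A) →
  count P? (concatMap (λ x → f x ∷ g x ∷ []) xs) ≡ count (P? ∘ f) xs + count (P? ∘ g) xs
count-interleave P? f g [] = refl
count-interleave P? f g (x ∷ xs) with P? (f x)
... | yes _ with P? (g x)
...   | yes _ = cong suc (trans (cong suc (count-interleave P? f g xs)) (sym (+-suc _ _)))
...   | no _  = cong suc (count-interleave P? f g xs)
count-interleave P? f g (x ∷ xs) | no _ with P? (g x)
...   | yes _ = trans (cong suc (count-interleave P? f g xs)) (sym (+-suc _ _))
...   | no _  = count-interleave P? f g xs

count-concatMap-≤ : {A B : Set} {P : B → Set} (P? : Decidable P) (f : A → List B) (xs : List A) →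
  (∀ {x} → x ∈ₗ xs → count P? (f x) ≤ 1) → count P? (concatMap f xs) ≤ length xs
count-concatMap-≤ P? f [] _ = z≤n
count-concatMap-≤ P? f (x ∷ xs) block≤1 = begin
  count P? (f x ++ concatMap f xs)           ≡⟨ count-++ P? (f x) (concatMap f xs) ⟩
  count P? (f x) + count P? (concatMap f xs) ≤⟨ +-mono-≤ (block≤1 (Any.here refl))
                                                  (count-concatMap-≤ P? f xs (block≤1 ∘ Any.there)) ⟩
  1 + length xs                              ∎
  where open ≤-Reasoning

_≟ₛ_ : {P : ℕ} → DecidableEquality (Subset P)
_≟ₛ_ = ≡-dec _≟ᵇ_

count-allSubsets-suc : (P : ℕ) {Q : Subset (suc P) → Set} (Q? : Decidable Q) →
  count Q? (allSubsets (suc P))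
    ≡ count (Q? ∘ (inside ∷_)) (allSubsets P) + count (Q? ∘ (outside ∷_)) (allSubsets P)
count-allSubsets-suc P Q? = count-interleave Q? (inside ∷_) (outside ∷_) (allSubsets P)

-- There are (P choose k) subsets of size k (Pascal's rule).
kSubsets-length : ∀ k P → length (kSubsets k P) ≡ P C k
kSubsets-length zero    zero    = refl
kSubsets-length (suc k) zero    = refl
kSubsets-length zero    (suc P) = begin
  count (λ s → ∣ s ∣ₛ ℕ.≟ 0) (allSubsets (suc P))
    ≡⟨ count-allSubsets-suc P (λ s → ∣ s ∣ₛ ℕ.≟ 0) ⟩
  count (λ s → suc ∣ s ∣ₛ ℕ.≟ 0) (allSubsets P) + length (kSubsets 0 P)
    ≡⟨ cong₂ _+_ (count-none _ (allSubsets P) λ ()) (kSubsets-length 0 P) ⟩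
  suc P C 0 ∎
  where open ≡-Reasoning
kSubsets-length (suc k) (suc P) = begin
  count (λ s → ∣ s ∣ₛ ℕ.≟ suc k) (allSubsets (suc P))
    ≡⟨ count-allSubsets-suc P (λ s → ∣ s ∣ₛ ℕ.≟ suc k) ⟩
  count (λ s → suc ∣ s ∣ₛ ℕ.≟ suc k) (allSubsets P) + length (kSubsets (suc k) P)
    ≡⟨ cong (_+ length (kSubsets (suc k) P))
         (count-cong _ (λ s → ∣ s ∣ₛ ℕ.≟ k) (allSubsets P) suc-injective (cong suc)) ⟩
  length (kSubsets k P) + length (kSubsets (suc k) P)
    ≡⟨ cong₂ _+_ (kSubsets-length k P) (kSubsets-length (suc k) P) ⟩
  P C k + P C suc k
    ≡⟨ nCk+nC[k+1]≡[n+1]C[k+1] P k ⟩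
  suc P C suc k ∎
  where open ≡-Reasoning

kSubsets-1-length : ∀ P → length (kSubsets 1 P) ≡ P
kSubsets-1-length P = trans (kSubsets-length 1 P) (nC1≡n P)

allSubsets-once : {P : ℕ} (x : Subset P) → count (_≟ₛ x) (allSubsets P) ≡ 1
allSubsets-once [] = refl
allSubsets-once {suc P} (inside ∷ x) = begin
  count (_≟ₛ (inside ∷ x)) (allSubsets (suc P))
    ≡⟨ count-allSubsets-suc P (_≟ₛ (inside ∷ x)) ⟩
  count (λ s → (inside ∷ s) ≟ₛ (inside ∷ x)) (allSubsets P)
    + count (λ s → (outside ∷ s) ≟ₛ (inside ∷ x)) (allSubsets P)
    ≡⟨ cong₂ _+_ (count-cong _ (_≟ₛ x) (allSubsets P) ∷-injectiveʳ (cong (inside ∷_)))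
                 (count-none _ (allSubsets P) λ ()) ⟩
  count (_≟ₛ x) (allSubsets P) + 0
    ≡⟨ +-identityʳ _ ⟩
  count (_≟ₛ x) (allSubsets P)
    ≡⟨ allSubsets-once x ⟩
  1 ∎
  where open ≡-Reasoning
allSubsets-once {suc P} (outside ∷ x) = begin
  count (_≟ₛ (outside ∷ x)) (allSubsets (suc P))
    ≡⟨ count-allSubsets-suc P (_≟ₛ (outside ∷ x)) ⟩
  count (λ s → (inside ∷ s) ≟ₛ (outside ∷ x)) (allSubsets P)
    + count (λ s → (outside ∷ s) ≟ₛ (outside ∷ x)) (allSubsets P)
    ≡⟨ cong₂ _+_ (count-none _ (allSubsets P) λ ())
                 (count-cong _ (_≟ₛ x) (allSubsets P) ∷-injectiveʳ (cong (outside ∷_))) ⟩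
  count (_≟ₛ x) (allSubsets P)
    ≡⟨ allSubsets-once x ⟩
  1 ∎
  where open ≡-Reasoning

kSubsets-at-most-once : ∀ k {P} (x : Subset P) → count (_≟ₛ x) (kSubsets k P) ≤ 1
kSubsets-at-most-once k {P} x = subst (count (_≟ₛ x) (kSubsets k P) ≤_) (allSubsets-once x)
  (count-filter (_≟ₛ x) (λ s → ∣ s ∣ₛ ℕ.≟ k) (allSubsets P))

tuple-entries : {A : Set} (xs : List A) (m : ℕ) {v : Vec A m} →
  v ∈ₗ tuples xs m → ∀ i → lookup v i ∈ₗ xs
tuple-entries xs (suc m) v∈tuples i
  with x , x∈xs , v∈block ← find (∈-concatMap⁻ (λ y → map (y ∷_) (tuples xs m)) {xs} v∈tuples)
  with w , w∈tuples , refl ← ∈-map⁻ (x ∷_) v∈block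
  with i
... | zero  = x∈xs
... | suc j = tuple-entries xs m w∈tuples j

tuples-single : {A : Set} (x : A) (n : ℕ) → tuples (x ∷ []) n ≡ replicate n x ∷ []
tuples-single x zero    = refl
tuples-single x (suc n) = trans (++-identityʳ _) (cong (map (x ∷_)) (tuples-single x n))

module Multiplicity {A : Set} (_≟_ : DecidableEquality A) where

  _≟ᵥ_ : {m : ℕ} → DecidableEquality (Vec A m)
  _≟ᵥ_ = ≡-dec _≟_

  count-prefixed : {m : ℕ} (xs : List A) (T : List (Vec A m)) (x : A) (r : Vec A m) →
    count (_≟ᵥ (x ∷ r)) (concatMap (λ y → map (y ∷_) T) xs) ≡ count (_≟ x) xs * count (_≟ᵥ r) T
  count-prefixed [] T x r = refl
  count-prefixed (y ∷ ys) T x r with y ≟ x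
  ... | yes refl = trans (count-++ (_≟ᵥ (x ∷ r)) (map (x ∷_) T) _)
                         (cong₂ _+_ same-head (count-prefixed ys T x r))
    where
    same-head : count (_≟ᵥ (x ∷ r)) (map (x ∷_) T) ≡ count (_≟ᵥ r) T
    same-head = trans (count-map (_≟ᵥ (x ∷ r)) (x ∷_) T)
                      (count-cong _ (_≟ᵥ r) T ∷-injectiveʳ (cong (x ∷_)))
  ... | no y≢x   = trans (count-++ (_≟ᵥ (x ∷ r)) (map (y ∷_) T) _)
                         (cong₂ _+_ other-head (count-prefixed ys T x r))
    where
    other-head : count (_≟ᵥ (x ∷ r)) (map (y ∷_) T) ≡ 0
    other-head = trans (count-map (_≟ᵥ (x ∷ r)) (y ∷_) T)
                       (count-none _ T (y≢x ∘ ∷-injectiveˡ))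

  count-replicate : (xs : List A) (m : ℕ) (x : A) →
    count (_≟ᵥ replicate m x) (tuples xs m) ≡ count (_≟ x) xs ^ m
  count-replicate xs zero    x = refl
  count-replicate xs (suc m) x =
    trans (count-prefixed xs (tuples xs m) x (replicate m x))
          (cong (count (_≟ x) xs *_) (count-replicate xs m x))

  replicate-at-most-once : (xs : List A) (m : ℕ) (x : A) →
    count (_≟ x) xs ≤ 1 → count (_≟ᵥ replicate m x) (tuples xs m) ≤ 1
  replicate-at-most-once xs m x once = subst₂ _≤_
    (sym (count-replicate xs m x)) (^-zeroˡ m) (^-monoˡ-≤ m once)

size-zero-empty : {n : ℕ} (p : Subset n) → ∣ p ∣ₛ ≡ 0 → p ≡ ⊥
size-zero-empty []            _    = refl
size-zero-empty (outside ∷ p) size = cong (outside ∷_) (size-zero-empty p size)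

size-one-singleton : {n : ℕ} {p : Subset n} {x : Fin n} → x ∈ p → ∣ p ∣ₛ ≡ 1 → p ≡ ⁅ x ⁆
size-one-singleton {p = inside ∷ p} here size =
  cong (inside ∷_) (size-zero-empty p (suc-injective size))
size-one-singleton {p = inside ∷ p} (there x∈p) size =
  ⊥-elim (∉⊥ (subst (_ ∈_) (size-zero-empty p (suc-injective size)) x∈p))
size-one-singleton {p = outside ∷ p} (there x∈p) size =
  cong (outside ∷_) (size-one-singleton x∈p size)

overlapping-singletons : {n : ℕ} {a b : Subset n} →
  ∣ a ∣ₛ ≡ 1 → ∣ b ∣ₛ ≡ 1 → Nonempty (a ∩ b) → a ≡ b
overlapping-singletons {a = a} {b} size-a size-b (x , x∈a∩b) =
  let x∈a , x∈b = x∈p∩q⁻ a b x∈a∩b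
  in trans (size-one-singleton x∈a size-a) (sym (size-one-singleton x∈b size-b))

SingletonRings : {n P : ℕ} → Vec (Subset P) n → Set
SingletonRings keys = ∀ i → ∣ lookup keys i ∣ₛ ≡ 1

-- With singleton rings, adjacent nodes hold the same key, hence so do nodes joined by a path.
reach-same-ring : {n P : ℕ} {keys : Vec (Subset P) n} → SingletonRings keys →
  ∀ {i j} → Reach keys i j → lookup keys i ≡ lookup keys j
reach-same-ring singletons here = refl
reach-same-ring singletons (step {i} {j} (_ , shared) path) =
  trans (overlapping-singletons (singletons i) (singletons j) shared) (reach-same-ring singletons path)

all-equal-replicate : {A : Set} {m : ℕ} (x : A) (v : Vec A m) → (∀ i → lookup v i ≡ x) → v ≡ replicate m x
all-equal-replicate x []      _     = refl
all-equal-replicate x (y ∷ v) equal = cong₂ _∷_ (equal zero) (all-equal-replicate x v (equal ∘ suc))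

connected-constant : {m P : ℕ} (x : Subset P) (v : Vec (Subset P) m) →
  SingletonRings (x ∷ v) → Connected (x ∷ v) → v ≡ replicate m x
connected-constant x v singletons connected =
  all-equal-replicate x v (λ i → sym (reach-same-ring singletons (connected zero (suc i))))

-- If all nodes hold the same nonempty ring, the key graph is complete, hence connected.
shared-ring-connected : {n P : ℕ} {a : Subset P} → Nonempty a → Connected (replicate n a)
shared-ring-connected {a = a} (k , k∈a) i j with i ≟ᶠ j
... | yes refl = here
... | no i≢j   = step (i≢j , shared) here
  where
  shared : Nonempty (lookup (replicate _ a) i ∩ lookup (replicate _ a) j)
  shared = subst₂ (λ u w → Nonempty (u ∩ w)) (sym (lookup-replicate i a)) (sym (lookup-replicate j a))
                  (k , x∈p∩q⁺ (k∈a , k∈a))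

open module SubsetMultiplicity {P : ℕ} = Multiplicity (_≟ₛ_ {P}) using (_≟ᵥ_; replicate-at-most-once)

-- For K = 1 and n ≥ 1 at most P of the realisations are connected: one per key.
connected-realisations-≤ : (dec : ConnDecider) (P m : ℕ) →
  count dec (tuples (kSubsets 1 P) (suc m)) ≤ length (kSubsets 1 P)
connected-realisations-≤ dec P m = count-concatMap-≤ dec (λ x → map (x ∷_) (tuples rings m)) rings block
  where
  rings : List (Subset P)
  rings = kSubsets 1 P

  size-one : ∀ {x} → x ∈ₗ rings → ∣ x ∣ₛ ≡ 1
  size-one x∈rings = proj₂ (∈-filter⁻ (λ s → ∣ s ∣ₛ ℕ.≟ 1) {xs = allSubsets P} x∈rings)

  block : ∀ {x} → x ∈ₗ rings → count dec (map (x ∷_) (tuples rings m)) ≤ 1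
  block {x} x∈rings = begin
    count dec (map (x ∷_) (tuples rings m))        ≡⟨ count-map dec (x ∷_) (tuples rings m) ⟩
    count (dec ∘ (x ∷_)) (tuples rings m)          ≤⟨ count-mono _ (_≟ᵥ replicate m x) (tuples rings m)
                                                        (λ v∈tuples → connected-constant x _ (singletons v∈tuples)) ⟩
    count (_≟ᵥ replicate m x) (tuples rings m)     ≤⟨ replicate-at-most-once rings m x (kSubsets-at-most-once 1 x) ⟩
    1                                              ∎
    where
    open ≤-Reasoning
    singletons : ∀ {v} → v ∈ₗ tuples rings m → SingletonRings (x ∷ v)
    singletons v∈tuples zero    = size-one x∈rings
    singletons v∈tuples (suc i) = size-one (tuple-entries rings m v∈tuples i)

connProb-single-key : (dec : ConnDecider) (n : ℕ) → connProb dec n 1 1 ≡ 1ℚ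
connProb-single-key dec n = cong₂ ratio all-connected (^-zeroˡ n)
  where
  key : Subset 1
  key = inside ∷ []

  all-connected : count dec (tuples (kSubsets 1 1) n) ≡ 1
  all-connected = trans (cong (count dec) (tuples-single key n))
                        (count-single dec (shared-ring-connected (zero , here)))

n<2^n : ∀ n → n < 2 ^ n
n<2^n zero    = s≤s z≤n
n<2^n (suc n) = begin-strict
  suc n           <⟨ s≤s (n<2^n n) ⟩
  suc (2 ^ n)     ≤⟨ +-monoˡ-≤ (2 ^ n) (m^n>0 2 n) ⟩
  2 ^ n + 2 ^ n   ≡⟨ cong (λ k → 2 ^ n + k) (sym (+-identityʳ (2 ^ n))) ⟩
  2 ^ suc n       ∎
  where open ≤-Reasoning

-- With a ≤ N, N ≥ 2 and 1 + q ≤ m:  a (1 + q) < (1 + p) N^(1+m),  i.e.  a / N^(1+m) < (1+p)/(1+q).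
fraction-bound : ∀ {a N m} p q → a ≤ N → 2 ≤ N → suc q ≤ m → a * suc q < suc p * N ^ suc m
fraction-bound {a} {N} {m} p q a≤N 2≤N q<m = begin-strict
  a * suc q         ≤⟨ *-monoˡ-≤ (suc q) a≤N ⟩
  N * suc q         <⟨ *-monoʳ-< N (≤-<-trans q<m (<-≤-trans (n<2^n m) (^-monoˡ-≤ m 2≤N))) ⟩
  N ^ suc m         ≤⟨ m≤n*m (N ^ suc m) (suc p) ⟩
  suc p * N ^ suc m ∎
  where
  open ≤-Reasoning
  instance
    N≢0 : ℕ.NonZero N
    N≢0 = >-nonZero (≤-trans (s≤s z≤n) 2≤N)

ratio-below : ∀ a d k q .(c : Coprime k (suc q)) → a * suc q < k * d → ∣ ratio a d - 0ℚ ∣ <ℚ mkℚ (+ k) q c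
ratio-below a zero    k q c small = ⊥-elim (n≮0 (subst (a * suc q <_) (*-zeroʳ k) small))
ratio-below a (suc d) k q c small = subst (_<ℚ mkℚ (+ k) q c) (sym distance) below
  where
  x : ℚ
  x = ratio a (suc d)

  distance : ∣ x - 0ℚ ∣ ≡ x
  distance = trans (cong ∣_∣ (+-identityʳℚ x))
                   (0≤p⇒∣p∣≡p (nonNegative⁻¹ x {{normalize-nonNeg a (suc d)}}))

  -- The comparison is made on the unnormalised fraction a/(1+d).
  below : x <ℚ mkℚ (+ k) q c
  below = toℚᵘ-cancel-< (ℚᵘ.<-respˡ-≃ (ℚᵘ.≃-sym (toℚᵘ-fromℚᵘ (mkℚᵘ (+ a) d)))
            (ℚᵘ.*<* (subst₂ ℤ._<_ (pos-* a (suc q)) (pos-* k (suc d)) (ℤ.+<+ small))))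

fraction-tendsto-zero : (a N : ℕ → ℕ) (N₀ : ℕ) → (∀ n → n ≥ N₀ → 2 ≤ N n) →
  (∀ m → a (suc m) ≤ N (suc m)) → Tendsto (λ n → ratio (a n) (N n ^ n)) 0ℚ
fraction-tendsto-zero a N N₀ N≥2 a≤N (mkℚ (+ zero) q c) (*<* (ℤ.+<+ ()))
fraction-tendsto-zero a N N₀ N≥2 a≤N (mkℚ -[1+ p ] q c) (*<* ())
fraction-tendsto-zero a N N₀ N≥2 a≤N (mkℚ +[1+ p ] q c) _ = N₀ ⊔ suc (suc q) , close
  where
  close : ∀ n → n ≥ N₀ ⊔ suc (suc q) → ∣ ratio (a n) (N n ^ n) - 0ℚ ∣ <ℚ mkℚ +[1+ p ] q c
  close zero    n≥ with () ← ≤-trans (m≤n⊔m N₀ (suc (suc q))) n≥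
  close (suc m) n≥ = ratio-below (a (suc m)) (N (suc m) ^ suc m) (suc p) q c
    (fraction-bound p q (a≤N m) (N≥2 (suc m) (≤-trans (m≤m⊔n N₀ (suc (suc q))) n≥))
                        (≤-pred (≤-trans (m≤n⊔m N₀ (suc (suc q))) n≥)))

eventually-constant-tendsto : (u : ℕ → ℚ) (l : ℚ) → ∃[ N ] (∀ n → n ≥ N → u n ≡ l) → Tendsto u l
eventually-constant-tendsto u l (N , u≡l) ε ε>0 = N , λ n n≥N → subst (_<ℚ ε) (sym (distance n n≥N)) ε>0
  where
  distance : ∀ n → n ≥ N → ∣ u n - l ∣ ≡ 0ℚ
  distance n n≥N = trans (cong (λ r → ∣ r - l ∣) (u≡l n n≥N)) (cong ∣_∣ (+-inverseʳ l))

connProb-vanishes : (dec : ConnDecider) (Pₙ : ℕ → ℕ) (N₀ : ℕ) → (∀ n → n ≥ N₀ → 2 ≤ Pₙ n) →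
  Tendsto (λ n → connProb dec n 1 (Pₙ n)) 0ℚ
connProb-vanishes dec Pₙ N₀ Pₙ≥2 =
  fraction-tendsto-zero (λ n → count dec (tuples (kSubsets 1 (Pₙ n)) n)) (λ n → length (kSubsets 1 (Pₙ n))) N₀
    (λ n n≥N₀ → subst (2 ≤_) (sym (kSubsets-1-length (Pₙ n))) (Pₙ≥2 n n≥N₀))
    (λ m → connected-realisations-≤ dec (Pₙ (suc m)) m)

lemma1 : (dec : ConnDecider) (Pₙ : ℕ → ℕ) →
    ((L : ℕ) → ConvergesToℕ Pₙ L → L > 1 → Tendsto (λ n → connProb dec n 1 (Pₙ n)) 0ℚ)
    × (DivergesToInfinity Pₙ → Tendsto (λ n → connProb dec n 1 (Pₙ n)) 0ℚ)
    × (ConvergesToℕ Pₙ 1 → Tendsto (λ n → connProb dec n 1 (Pₙ n)) 1ℚ)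
lemma1 dec Pₙ = finite-limit , infinite-limit , limit-one
  where
  finite-limit : (L : ℕ) → ConvergesToℕ Pₙ L → L > 1 → Tendsto (λ n → connProb dec n 1 (Pₙ n)) 0ℚ
  finite-limit L (N , Pₙ≡L) L>1 = connProb-vanishes dec Pₙ N (λ n n≥N → subst (2 ≤_) (sym (Pₙ≡L n n≥N)) L>1)

  infinite-limit : DivergesToInfinity Pₙ → Tendsto (λ n → connProb dec n 1 (Pₙ n)) 0ℚ
  infinite-limit Pₙ→∞ = let N , Pₙ≥2 = Pₙ→∞ 2 in connProb-vanishes dec Pₙ N Pₙ≥2

  limit-one : ConvergesToℕ Pₙ 1 → Tendsto (λ n → connProb dec n 1 (Pₙ n)) 1ℚ
  limit-one (N , Pₙ≡1) = eventually-constant-tendsto _ 1ℚ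
    (N , λ n n≥N → trans (cong (connProb dec n 1) (Pₙ≡1 n n≥N)) (connProb-single-key dec n))
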